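{- Let $\ell$ be a positive integer. Then $\frac{C_{0}(\ell,1)}{\ell(\ell+1)}=1$. Moreover, for every integer $a>1$, both $\frac{C_{0}(\ell,a)}{\ell(\ell+1)}$ and $C_1(\ell,a)$ are even integers.
   Context: For $\ell,a\in\mathbb{N}$, the integers $C_0(\ell,a),\dots,C_a(\ell,a)$ are the (unique, independent of $k$) coefficients such that for all $k$, \[ k^{a}(k+1)^{a}=\sum_{u=0}^{a}C_{u}(\ell,a)\prod_{v=1}^{u}\bigl(k(k+1)-(\ell+v-1)(\ell+v)\bigr) \] (the empty product being $1$). -}

module Defs where

open import Data.Nat using (ℕ; zero; suc)
open import Data.Integer using (ℤ; +_; _+_; _-_; _*_; _^_)
open import Relation.Binary.PropositionalEquality using (_≡_)

ΠTerm : ℕ → ℤ → ℕ → ℤ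
ΠTerm ℓ k zero    = + 1
ΠTerm ℓ k (suc u) = ΠTerm ℓ k u * (k * (k + + 1) - (+ ℓ + + u) * (+ ℓ + + u + + 1))

sumTo : ℕ → (ℕ → ℤ) → ℤ
sumTo zero    f = f zero
sumTo (suc n) f = sumTo n f + f (suc n)

-- C (indexed by u = 0..a; values at u > a are irrelevant) is the coefficient
-- family C_u(ℓ,a): for all k,
--   k^a (k+1)^a = ∑_{u=0}^{a} C_u ∏_{v=1}^{u} (k(k+1) - (ℓ+v-1)(ℓ+v)).
IsCoeffs : ℕ → ℕ → (ℕ → ℤ) → Set
IsCoeffs ℓ a C = ∀ (k : ℤ) → k ^ a * (k + + 1) ^ a ≡ sumTo a (λ u → C u * ΠTerm ℓ k u)

-- Put t₁ = ℓ(ℓ+1) and t₂ = (ℓ+1)(ℓ+2). At k = ℓ every product with u ≥ 1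
-- contains the factor k(k+1) − ℓ(ℓ+1) = 0, so C₀ = t₁ᵃ. At k = ℓ+1 every
-- product with u ≥ 2 contains k(k+1) − (ℓ+1)(ℓ+2) = 0, so
-- t₂ᵃ = C₀ + C₁ (t₂ − t₁) and C₁ = (t₂ᵃ − t₁ᵃ)/(t₂ − t₁) = Σᵢ t₂ⁱ t₁ᵃ⁻¹⁻ⁱ.
-- Products of consecutive integers are even, so for a ≥ 2 both t₁ᵃ/t₁ and
-- every term of that sum are even.
module Submission where

open import Defs
open import Data.Nat as ℕ using (ℕ; _≤_; _<_; zero; suc; s≤s)
open import Data.Integer using (ℤ; +_; _*_; _+_; _-_; _^_)
import Data.Integer.Properties as ℤ
open import Data.Integer.Tactic.RingSolver using (solve-∀)
open import Algebra.Properties.AbelianGroup ℤ.+-0-abelianGroup using (∙-cancelˡ)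
open import Data.Product using (_×_; ∃; _,_)
open import Relation.Binary.PropositionalEquality
open ≡-Reasoning

pronic : ℤ → ℤ
pronic k = k * (k + + 1)

^-distribʳ-* : ∀ x y n → x ^ n * y ^ n ≡ (x * y) ^ n
^-distribʳ-* x y zero    = refl
^-distribʳ-* x y (suc n) = begin
  (x * x ^ n) * (y * y ^ n) ≡⟨ interchange x y (x ^ n) (y ^ n) ⟩
  (x * y) * (x ^ n * y ^ n) ≡⟨ cong ((x * y) *_) (^-distribʳ-* x y n) ⟩
  (x * y) * (x * y) ^ n     ∎
  where
  interchange : ∀ x y p q → (x * p) * (y * q) ≡ (x * y) * (p * q)
  interchange = solve-∀

-- geomQuot x y n = Σ_{i<n} yⁱ xⁿ⁻¹⁻ⁱ, the quotient (yⁿ − xⁿ)/(y − x).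
geomQuot : ℤ → ℤ → ℕ → ℤ
geomQuot x y zero    = + 0
geomQuot x y (suc n) = y ^ n + x * geomQuot x y n

^-difference : ∀ x y n → y ^ n ≡ x ^ n + (y - x) * geomQuot x y n
^-difference x y zero    = sym (trans (cong (_+_ (+ 1)) (ℤ.*-zeroʳ (y - x))) (ℤ.+-identityʳ (+ 1)))
^-difference x y (suc n) = begin
  y * y ^ n                              ≡⟨ cong (y *_) (^-difference x y n) ⟩
  y * (x ^ n + (y - x) * g)              ≡⟨ regroup x y (x ^ n) g ⟩
  x * x ^ n + (y - x) * ((x ^ n + (y - x) * g) + x * g)
    ≡⟨ cong (λ p → x * x ^ n + (y - x) * (p + x * g)) (sym (^-difference x y n)) ⟩
  x * x ^ n + (y - x) * (y ^ n + x * g)  ∎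
  where
  g : ℤ
  g = geomQuot x y n
  regroup : ∀ x y p g → y * (p + (y - x) * g) ≡ x * p + (y - x) * ((p + (y - x) * g) + x * g)
  regroup = solve-∀

Even : ℤ → Set
Even x = ∃ λ m → x ≡ + 2 * m

even-*ʳ : ∀ {x} → Even x → ∀ y → Even (x * y)
even-*ʳ (m , refl) y = m * y , ℤ.*-assoc (+ 2) m y

even-+ : ∀ {x y} → Even x → Even y → Even (x + y)
even-+ (m , refl) (n , refl) = m + n , sym (ℤ.*-distribˡ-+ (+ 2) m n)

pronic-even : ∀ n → Even (pronic (+ n))
pronic-even zero    = + 0 , refl
pronic-even (suc n) with pronic-even n
... | m , eq = m + (+ 1 + + n) , (begin
  pronic (+ 1 + + n)                  ≡⟨ pronic-suc (+ n) ⟩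
  pronic (+ n) + + 2 * (+ 1 + + n)    ≡⟨ cong (_+ + 2 * (+ 1 + + n)) eq ⟩
  + 2 * m + + 2 * (+ 1 + + n)         ≡⟨ ℤ.*-distribˡ-+ (+ 2) m (+ 1 + + n) ⟨
  + 2 * (m + (+ 1 + + n))             ∎)
  where
  pronic-suc : ∀ k → (+ 1 + k) * (+ 1 + k + + 1) ≡ k * (k + + 1) + + 2 * (+ 1 + k)
  pronic-suc = solve-∀

pronic-step : ∀ k → pronic (k + + 1) - pronic k ≡ + 2 * (+ 1 + k)
pronic-step = expanded
  where
  expanded : ∀ k → (k + + 1) * (k + + 1 + + 1) - k * (k + + 1) ≡ + 2 * (+ 1 + k)
  expanded = solve-∀

geomQuot-even : ∀ {x y} → Even x → Even y → ∀ n → Even (geomQuot x y (suc (suc n)))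
geomQuot-even {x} {y} ex ey n = even-+ (even-*ʳ ey (y ^ n)) (even-*ʳ ex (geomQuot x y (suc n)))

sumTo-support-0 : ∀ a (f : ℕ → ℤ) → (∀ u → f (suc u) ≡ + 0) → sumTo a f ≡ f 0
sumTo-support-0 zero    f f≡0 = refl
sumTo-support-0 (suc a) f f≡0 =
  trans (cong₂ _+_ (sumTo-support-0 a f f≡0) (f≡0 a)) (ℤ.+-identityʳ (f 0))

sumTo-support-1 : ∀ a (f : ℕ → ℤ) → (∀ u → f (suc (suc u)) ≡ + 0) → sumTo (suc a) f ≡ f 0 + f 1
sumTo-support-1 zero    f f≡0 = refl
sumTo-support-1 (suc a) f f≡0 =
  trans (cong₂ _+_ (sumTo-support-1 a f f≡0) (f≡0 a)) (ℤ.+-identityʳ (f 0 + f 1))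

ΠTerm-suc-zero : ∀ ℓ k u → ΠTerm ℓ k u ≡ + 0 → ΠTerm ℓ k (suc u) ≡ + 0
ΠTerm-suc-zero ℓ k u eq = trans (cong (_* factor) eq) (ℤ.*-zeroˡ factor)
  where
  factor : ℤ
  factor = pronic k - pronic (+ ℓ + + u)

ΠTerm-one : ∀ ℓ k → ΠTerm ℓ k 1 ≡ pronic k - pronic (+ ℓ)
ΠTerm-one ℓ k = trans (ℤ.*-identityˡ _) (cong (λ j → pronic k - pronic j) (ℤ.+-identityʳ (+ ℓ)))

ΠTerm-at-ℓ : ∀ ℓ u → ΠTerm ℓ (+ ℓ) (suc u) ≡ + 0
ΠTerm-at-ℓ ℓ zero    = trans (ΠTerm-one ℓ (+ ℓ)) (ℤ.+-inverseʳ (pronic (+ ℓ)))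
ΠTerm-at-ℓ ℓ (suc u) = ΠTerm-suc-zero ℓ (+ ℓ) (suc u) (ΠTerm-at-ℓ ℓ u)

ΠTerm-at-ℓ+1 : ∀ ℓ u → ΠTerm ℓ (+ ℓ + + 1) (suc (suc u)) ≡ + 0
ΠTerm-at-ℓ+1 ℓ zero    = trans (cong (first-factor *_) (ℤ.+-inverseʳ (pronic (+ ℓ + + 1))))
                               (ℤ.*-zeroʳ first-factor)
  where
  first-factor : ℤ
  first-factor = ΠTerm ℓ (+ ℓ + + 1) 1
ΠTerm-at-ℓ+1 ℓ (suc u) = ΠTerm-suc-zero ℓ (+ ℓ + + 1) (suc (suc u)) (ΠTerm-at-ℓ+1 ℓ u)

module Evaluation (ℓ : ℕ) where

  t₁ t₂ : ℤ
  t₁ = pronic (+ ℓ)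
  t₂ = pronic (+ ℓ + + 1)

  evaluation : ∀ a C → IsCoeffs ℓ a C → ∀ k → pronic k ^ a ≡ sumTo a (λ u → C u * ΠTerm ℓ k u)
  evaluation a C h k = trans (sym (^-distribʳ-* k (k + + 1) a)) (h k)

  coeff₀ : ∀ a C → IsCoeffs ℓ a C → C 0 ≡ t₁ ^ a
  coeff₀ a C h = begin
    C 0                                       ≡⟨ ℤ.*-identityʳ (C 0) ⟨
    C 0 * + 1                                 ≡⟨ sumTo-support-0 a (λ u → C u * ΠTerm ℓ (+ ℓ) u) higher≡0 ⟨
    sumTo a (λ u → C u * ΠTerm ℓ (+ ℓ) u)     ≡⟨ evaluation a C h (+ ℓ) ⟨
    t₁ ^ a                                    ∎
    where
    higher≡0 : ∀ u → C (suc u) * ΠTerm ℓ (+ ℓ) (suc u) ≡ + 0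
    higher≡0 u = trans (cong (C (suc u) *_) (ΠTerm-at-ℓ ℓ u)) (ℤ.*-zeroʳ (C (suc u)))

  value-at-ℓ+1 : ∀ a C → IsCoeffs ℓ (suc a) C → t₂ ^ suc a ≡ t₁ ^ suc a + C 1 * (t₂ - t₁)
  value-at-ℓ+1 a C h = begin
    t₂ ^ suc a                                                  ≡⟨ evaluation (suc a) C h (+ ℓ + + 1) ⟩
    sumTo (suc a) (λ u → C u * ΠTerm ℓ (+ ℓ + + 1) u)           ≡⟨ sumTo-support-1 a (λ u → C u * ΠTerm ℓ (+ ℓ + + 1) u) higher≡0 ⟩
    C 0 * + 1 + C 1 * ΠTerm ℓ (+ ℓ + + 1) 1
      ≡⟨ cong₂ (λ c p → c + C 1 * p) (trans (ℤ.*-identityʳ (C 0)) (coeff₀ (suc a) C h)) (ΠTerm-one ℓ (+ ℓ + + 1)) ⟩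
    t₁ ^ suc a + C 1 * (t₂ - t₁)                                ∎
    where
    higher≡0 : ∀ u → C (suc (suc u)) * ΠTerm ℓ (+ ℓ + + 1) (suc (suc u)) ≡ + 0
    higher≡0 u = trans (cong (C (suc (suc u)) *_) (ΠTerm-at-ℓ+1 ℓ u)) (ℤ.*-zeroʳ (C (suc (suc u))))

  coeff₁ : ∀ a C → IsCoeffs ℓ (suc a) C → C 1 ≡ geomQuot t₁ t₂ (suc a)
  coeff₁ a C h = ℤ.*-cancelˡ-≡ (+ 2 * (+ 1 + + ℓ)) (C 1) (geomQuot t₁ t₂ (suc a)) (begin
    + 2 * (+ 1 + + ℓ) * C 1      ≡⟨ cong (_* C 1) (pronic-step (+ ℓ)) ⟨
    (t₂ - t₁) * C 1              ≡⟨ ℤ.*-comm (t₂ - t₁) (C 1) ⟩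
    C 1 * (t₂ - t₁)              ≡⟨ ∙-cancelˡ (t₁ ^ suc a) _ _ (trans (sym (value-at-ℓ+1 a C h)) (^-difference t₁ t₂ (suc a))) ⟩
    (t₂ - t₁) * q                ≡⟨ cong (_* q) (pronic-step (+ ℓ)) ⟩
    + 2 * (+ 1 + + ℓ) * q        ∎)
    where
    q : ℤ
    q = geomQuot t₁ t₂ (suc a)

lemma2p5 : (ℓ : ℕ) → 1 ≤ ℓ →
    ((C : ℕ → ℤ) → IsCoeffs ℓ 1 C → C 0 ≡ + ℓ * (+ ℓ + + 1))
    × ((a : ℕ) → 1 < a → (C : ℕ → ℤ) → IsCoeffs ℓ a C →
        (∃ λ (m : ℤ) → C 0 ≡ (+ ℓ * (+ ℓ + + 1)) * (+ 2 * m))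
        × (∃ λ (m : ℤ) → C 1 ≡ + 2 * m))
lemma2p5 ℓ _ = first , second
  where
  open Evaluation ℓ

  first : (C : ℕ → ℤ) → IsCoeffs ℓ 1 C → C 0 ≡ + ℓ * (+ ℓ + + 1)
  first C h = trans (coeff₀ 1 C h) (ℤ.*-identityʳ t₁)

  second : (a : ℕ) → 1 < a → (C : ℕ → ℤ) → IsCoeffs ℓ a C →
    (∃ λ (m : ℤ) → C 0 ≡ (+ ℓ * (+ ℓ + + 1)) * (+ 2 * m)) × Even (C 1)
  second (suc zero) (s≤s ())
  second (suc (suc b)) _ C h =
    C₀-even , subst Even (sym (coeff₁ (suc b) C h)) (geomQuot-even t₁-even t₂-even b)
    where
    t₁-even : Even t₁
    t₁-even = pronic-even ℓ
    t₂-even : Even t₂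
    t₂-even = pronic-even (ℓ ℕ.+ 1)
    C₀-even : ∃ λ m → C 0 ≡ t₁ * (+ 2 * m)
    C₀-even with even-*ʳ t₁-even (t₁ ^ b)
    ... | m , eq = m , trans (coeff₀ (suc (suc b)) C h) (cong (t₁ *_) eq)
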